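{- For $m\geqslant 1$, \[\mathcal{R}_{E,m}\coloneqq(\Phi_E^{ -1})^{(m)}\cdots(\Phi_E^{ -1})^{(1)}=\mathcal{T}_E\begin{pmatrix} \mathcal{B}_m(t) & \frac{\kappa_2}{t-\theta^{(1)}}\mathcal{B}_{m-1}^{(1)}(t)\\ \mathcal{B}_{m-1}(t) &\frac{\kappa_2}{t-\theta^{(1)}}\mathcal{B}_{m-2}^{(1)}(t) \end{pmatrix}.\]
   Context: Let $\phi:\mathsf{A}=\mathbb{F}_q[t]\to A[\tau]$ ($A=\mathbb{F}_q[\theta]$, $p\ne2$) be the Drinfeld module $\phi_t=\theta+\kappa_1\tau+\kappa_2\tau^2$ with $\kappa_2\in\mathbb{F}_q^\times$, and let $E$ be $\phi^{\otimes2}$, $\mathrm{Sym}^2\phi$ or $\mathrm{Alt}^2\phi$, with $\mathcal{T}_E$ the corresponding matrix operation on $2\times2$ matrices $M=(M_{ij})$: the Kronecker square $M^{\otimes2}$; $\mathrm{Sym}^2(M)=\begin{pmatrix}M_{11}^2&2M_{11}M_{12}&M_{12}^2\\ M_{11}M_{21}&M_{11}M_{22}+M_{12}M_{21}&M_{12}M_{22}\\ M_{21}^2&2M_{21}M_{22}&M_{22}^2\end{pmatrix}$; or $\mathrm{Alt}^2(M)=\det M$. Twisting $g^{(n)}$ raises coefficients to the $q^n$-th power (commuting with $t$), applied entrywise to matrices. $\Phi_E=\mathcal{T}_E(\Phi_\phi)$, with $\Phi_\phi=\begin{pmatrix}0&1\\ \frac{t-\theta}{\kappa_2}&-\frac{\kappa_1^{(-1)}}{\kappa_2}\end{pmatrix}$,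 is the matrix representing multiplication by $\sigma=\tau^{ -1}$ on the dual $t$-motive of $E$. The rational functions $\mathcal{B}_m(t)\in K(t)$ (El-Guindy–Papanikolas) satisfy $\mathcal{B}_m(\theta)=\beta_m$ where $\mathrm{Log}_\phi(z)=\sum_{m\ge0}\beta_mz^{q^m}$, $\mathcal{B}_m=0$ for $m<0$, $\mathcal{B}_0=1$, and $\mathcal{B}_m(t)=\frac{\kappa_1^{(m-1)}}{t-\theta^{(m)}}\mathcal{B}_{m-1}(t)+\frac{\kappa_2}{t-\theta^{(m)}}\mathcal{B}_{m-2}(t)$ for $m\ge1$. -}

module Defs where

open import Level using (Level; _⊔_) renaming (suc to lsuc)
open import Algebra.Bundles using (CommutativeRing)
open import Data.Nat using (ℕ; zero; suc) renaming (_^_ to _^ℕ_; _≥_ to _≥ℕ_)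
open import Data.Nat.Primality using (Prime)
open import Data.Fin using (Fin; zero; suc; remQuot; _≟_)
open import Data.Product using (_,_; proj₁; proj₂) renaming (_×_ to _∧_)
open import Relation.Nullary using (¬_; yes; no)
open import Relation.Binary.PropositionalEquality using (_≡_; _≢_)

module RingOps {c ℓ : Level} (R : CommutativeRing c ℓ) where
  open CommutativeRing R hiding (zero)

  pow : Carrier → ℕ → Carrier
  pow x zero    = 1#
  pow x (suc n) = x * pow x n

  ι : ℕ → Carrier
  ι zero    = 0#
  ι (suc n) = 1# + ι n

-- The setting of the paper, abstracted:
--   L      : a field standing for K(t) (K the perfect base field containing A = F_q[θ])
--   inK    : the subfield K ⊆ L
--   twist  : the twisting automorphism g ↦ g^(1) of L (coefficients raised to the q-th power,
--            t fixed); untwist is its inverse g ↦ g^(-1)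
--   t ∉ K, θ, κ₁ ∈ K, κ₂ ∈ F_q^× (i.e. κ₂ ∈ K, κ₂^q = κ₂, κ₂ ≠ 0), char L = p ≠ 2, q = p^e.
record Setting (c ℓ : Level) : Set (lsuc (c ⊔ ℓ)) where
  field
    L : CommutativeRing c ℓ
  open CommutativeRing L public hiding (zero)

  open RingOps L public

  field
    _⁻¹      : Carrier → Carrier
    ⁻¹-cong  : ∀ {x y} → x ≈ y → (x ⁻¹) ≈ (y ⁻¹)
    ⁻¹-inv   : ∀ x → ¬ (x ≈ 0#) → x * (x ⁻¹) ≈ 1#
    0≉1      : ¬ (0# ≈ 1#)
    p q e    : ℕ
    p-prime  : Prime p
    p≢2      : p ≢ 2
    e≥1      : e ≥ℕ 1
    q≡p^e    : q ≡ p ^ℕ e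
    char-p   : ι p ≈ 0#
    inK      : Carrier → Set ℓ
    inK-resp : ∀ {x y} → x ≈ y → inK x → inK y
    K-0      : inK 0#
    K-1      : inK 1#
    K-+      : ∀ {x y} → inK x → inK y → inK (x + y)
    K--      : ∀ {x} → inK x → inK (- x)
    K-*      : ∀ {x y} → inK x → inK y → inK (x * y)
    K-⁻¹     : ∀ {x} → inK x → inK (x ⁻¹)
    twist      : Carrier → Carrier
    untwist    : Carrier → Carrier
    twist-cong : ∀ {x y} → x ≈ y → twist x ≈ twist y
    untwist-cong : ∀ {x y} → x ≈ y → untwist x ≈ untwist y
    twist-+    : ∀ x y → twist (x + y) ≈ twist x + twist y
    twist-*    : ∀ x y → twist (x * y) ≈ twist x * twist y
    twist-1    : twist 1# ≈ 1#
    twist-untwist : ∀ x → twist (untwist x) ≈ x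
    untwist-twist : ∀ x → untwist (twist x) ≈ x
    twist-K    : ∀ {x} → inK x → twist x ≈ pow x q
    twist-Kin  : ∀ {x} → inK x → inK (twist x)
    untwist-Kin : ∀ {x} → inK x → inK (untwist x)
    t          : Carrier
    twist-t    : twist t ≈ t
    t∉K        : ∀ x → inK x → ¬ (t ≈ x)
    -- the Drinfeld module φ_t = θ + κ₁ τ + κ₂ τ²
    θ κ₁ κ₂    : Carrier
    θ∈K        : inK θ
    κ₁∈K       : inK κ₁
    κ₂∈K       : inK κ₂
    κ₂-Fq      : pow κ₂ q ≈ κ₂
    κ₂≉0       : ¬ (κ₂ ≈ 0#)

  twistⁿ : ℕ → Carrier → Carrier
  twistⁿ zero    x = x
  twistⁿ (suc n) x = twist (twistⁿ n x)

  -- (B_n , B_{n-1}) with B_0 = 1, B_{-1} = 0 and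
  -- B_m = κ₁^(m-1)/(t-θ^(m)) B_{m-1} + κ₂/(t-θ^(m)) B_{m-2}
  Bpair : ℕ → Carrier ∧ Carrier
  Bpair zero    = 1# , 0#
  Bpair (suc n) =
    let b = proj₁ (Bpair n) ; b' = proj₂ (Bpair n)
        d = (t - twistⁿ (suc n) θ) ⁻¹
    in (twistⁿ n κ₁ * d) * b + (κ₂ * d) * b' , b

  B : ℕ → Carrier
  B n = proj₁ (Bpair n)

  Bprev : ℕ → Carrier
  Bprev n = proj₂ (Bpair n)

  Mat : ℕ → Set c
  Mat n = Fin n → Fin n → Carrier

  _≈M_ : ∀ {n} → Mat n → Mat n → Set ℓ
  M ≈M N = ∀ i j → M i j ≈ N i j

  Σ : ∀ {n} → (Fin n → Carrier) → Carrier
  Σ {zero}  f = 0#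
  Σ {suc n} f = f zero + Σ (λ i → f (suc i))

  _*M_ : ∀ {n} → Mat n → Mat n → Mat n
  (M *M N) i j = Σ (λ k → M i k * N k j)

  IdM : ∀ {n} → Mat n
  IdM i j with i ≟ j
  ... | yes _ = 1#
  ... | no _  = 0#

  twistM : ∀ {k} → ℕ → Mat k → Mat k
  twistM n M i j = twistⁿ n (M i j)

  -- the three constructions E = φ^{⊗2}, Sym²φ, Alt²φ and the operations 𝒯_E
  data Kind : Set where
    tensorE symE altE : Kind

  dim : Kind → ℕ
  dim tensorE = 4
  dim symE    = 3
  dim altE    = 1

  m₁₁ m₁₂ m₂₁ m₂₂ : Mat 2 → Carrier
  m₁₁ M = M zero zero
  m₁₂ M = M zero (suc zero)
  m₂₁ M = M (suc zero) zero
  m₂₂ M = M (suc zero) (suc zero)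

  -- Kronecker square, rows/columns indexed by (i,j) ↦ 2i + j
  kron² : Mat 2 → Mat 4
  kron² M a b =
    let ij = remQuot {2} 2 a ; kl = remQuot {2} 2 b
    in M (proj₁ ij) (proj₁ kl) * M (proj₂ ij) (proj₂ kl)

  sym² : Mat 2 → Mat 3
  sym² M zero zero                   = m₁₁ M * m₁₁ M
  sym² M zero (suc zero)             = ι 2 * (m₁₁ M * m₁₂ M)
  sym² M zero (suc (suc zero))       = m₁₂ M * m₁₂ M
  sym² M (suc zero) zero             = m₁₁ M * m₂₁ M
  sym² M (suc zero) (suc zero)       = m₁₁ M * m₂₂ M + m₁₂ M * m₂₁ M
  sym² M (suc zero) (suc (suc zero)) = m₁₂ M * m₂₂ M
  sym² M (suc (suc zero)) zero             = m₂₁ M * m₂₁ M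
  sym² M (suc (suc zero)) (suc zero)       = ι 2 * (m₂₁ M * m₂₂ M)
  sym² M (suc (suc zero)) (suc (suc zero)) = m₂₂ M * m₂₂ M

  alt² : Mat 2 → Mat 1
  alt² M _ _ = m₁₁ M * m₂₂ M - m₁₂ M * m₂₁ M

  𝒯 : (E : Kind) → Mat 2 → Mat (dim E)
  𝒯 tensorE = kron²
  𝒯 symE    = sym²
  𝒯 altE    = alt²

  Φφ : Mat 2
  Φφ zero zero             = 0#
  Φφ zero (suc zero)       = 1#
  Φφ (suc zero) zero       = (t - θ) * (κ₂ ⁻¹)
  Φφ (suc zero) (suc zero) = - (untwist κ₁ * (κ₂ ⁻¹))

  ΦE : (E : Kind) → Mat (dim E)
  ΦE E = 𝒯 E Φφ

  𝓡 : ∀ {k} → Mat k → ℕ → Mat k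
  𝓡 N zero    = IdM
  𝓡 N (suc m) = twistM (suc m) N *M 𝓡 N m

  -- the 2×2 matrix ( B_m , κ₂/(t-θ^(1)) B_{m-1}^(1) ; B_{m-1} , κ₂/(t-θ^(1)) B_{m-2}^(1) ),
  -- written for m = suc k
  Bmat : ℕ → Mat 2
  Bmat k zero zero             = B (suc k)
  Bmat k zero (suc zero)       = (κ₂ * ((t - twist θ) ⁻¹)) * twist (B k)
  Bmat k (suc zero) zero       = B k
  Bmat k (suc zero) (suc zero) = (κ₂ * ((t - twist θ) ⁻¹)) * twist (Bprev k)

-- Φ_E⁻¹ = 𝒯_E(Φ_φ⁻¹): the operation 𝒯_E is multiplicative and unital, and a left inverse of
-- Φ_E agrees with any right inverse. As 𝒯_E also commutes with twisting, 𝓡_{E,m} = 𝒯_E(𝓡_{φ,m}),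
-- which reduces everything to E = φ. There (Φ_φ⁻¹)^(n+1) is the companion matrix of the
-- recursion B_{n+1} = κ₁^(n)/(t-θ^(n+1)) B_n + κ₂/(t-θ^(n+1)) B_{n-1}, and twisting it once gives
-- the next companion matrix. So left multiplication by (Φ_φ⁻¹)^(m+1) advances the first column
-- of the claimed matrix by the recursion and the second column by its twist.

module Submission where

open import Level using (Level)
open import Data.Nat using (ℕ; zero; suc)
open import Data.Fin using (Fin; zero; suc; _≟_; remQuot)
open import Data.Product using (_×_; proj₁; proj₂)
open import Data.Vec.N-ary using (N-ary)
open import Relation.Nullary using (¬_; yes; no)
open import Relation.Binary.Bundles using (Setoid)
import Relation.Binary.Reasoning.Setoid as SetoidReasoning
import Algebra.Properties.Ring as RingProperties
import Algebra.Solver.Ring.NaturalCoefficients.Default as NatSolver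
open import Defs

module Theory {c ℓ : Level} (S : Setting c ℓ) where
  open Setting S
  open RingProperties ring
    using (x+x≈x⇒x≈0; +-inverseˡ-unique; x∙y⁻¹≈ε⇒x≈y; -‿distribˡ-*; -‿distribʳ-*; -‿involutive; -‿+-comm; -0#≈0#)
  open NatSolver commutativeSemiring using (solve; _:=_; _:+_; _:*_; con; Polynomial)

  x+w≈z+y⇒x-y≈z-w : ∀ {x y z w} → x + w ≈ z + y → x - y ≈ z - w
  x+w≈z+y⇒x-y≈z-w {x} {y} {z} {w} eq = begin
    x - y                   ≈⟨ +-cong (+-identityʳ x) refl ⟨
    (x + 0#) - y            ≈⟨ +-cong (+-cong refl (-‿inverseʳ w)) refl ⟨
    (x + (w - w)) - y       ≈⟨ solve 4 (λ x w nw ny → (x :+ (w :+ nw)) :+ ny := (x :+ w) :+ (nw :+ ny)) refl x w (- w) (- y) ⟩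
    (x + w) + (- w + - y)   ≈⟨ +-cong eq refl ⟩
    (z + y) + (- w + - y)   ≈⟨ solve 4 (λ z y nw ny → (z :+ y) :+ (nw :+ ny) := (z :+ nw) :+ (y :+ ny)) refl z y (- w) (- y) ⟩
    (z - w) + (y - y)       ≈⟨ +-cong refl (-‿inverseʳ y) ⟩
    (z - w) + 0#            ≈⟨ +-identityʳ _ ⟩
    z - w                   ∎
    where open SetoidReasoning setoid

  [x-y]*[z-w]≈[xz+yw]-[xw+yz] : ∀ x y z w → (x - y) * (z - w) ≈ (x * z + y * w) - (x * w + y * z)
  [x-y]*[z-w]≈[xz+yw]-[xw+yz] x y z w = begin
    (x - y) * (z - w)                              ≈⟨ solve 4 (λ x ny z nw → (x :+ ny) :* (z :+ nw) := (x :* z :+ ny :* nw) :+ (x :* nw :+ ny :* z)) refl x (- y) z (- w) ⟩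
    (x * z + - y * - w) + (x * - w + - y * z)      ≈⟨ +-cong (+-cong refl -y*-w≈yw) (+-cong (sym (-‿distribʳ-* x w)) (sym (-‿distribˡ-* y z))) ⟩
    (x * z + y * w) + (- (x * w) + - (y * z))      ≈⟨ +-cong refl (-‿+-comm (x * w) (y * z)) ⟩
    (x * z + y * w) - (x * w + y * z)              ∎
    where
    open SetoidReasoning setoid
    -y*-w≈yw : - y * - w ≈ y * w
    -y*-w≈yw = trans (sym (-‿distribˡ-* y (- w))) (trans (-‿cong (sym (-‿distribʳ-* y w))) (-‿involutive (y * w)))

  x≈0⇒x*y≉1 : ∀ {x} y → x ≈ 0# → ¬ (x * y ≈ 1#)
  x≈0⇒x*y≉1 y x≈0 xy≈1 = 0≉1 (trans (sym (zeroˡ y)) (trans (*-cong (sym x≈0) refl) xy≈1))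

  x*y≈1⇒y≈x⁻¹ : ∀ {x y} → ¬ (x ≈ 0#) → x * y ≈ 1# → y ≈ x ⁻¹
  x*y≈1⇒y≈x⁻¹ {x} {y} x≉0 xy≈1 = begin
    y                  ≈⟨ *-identityˡ y ⟨
    1# * y             ≈⟨ *-cong (trans (*-comm (x ⁻¹) x) (⁻¹-inv x x≉0)) refl ⟨
    (x ⁻¹ * x) * y     ≈⟨ *-assoc (x ⁻¹) x y ⟩
    x ⁻¹ * (x * y)     ≈⟨ *-cong refl xy≈1 ⟩
    x ⁻¹ * 1#          ≈⟨ *-identityʳ _ ⟩
    x ⁻¹               ∎
    where open SetoidReasoning setoid

  t-x≉0 : ∀ {x} → inK x → ¬ (t - x ≈ 0#)
  t-x≉0 {x} x∈K t-x≈0 = t∉K x x∈K (x∙y⁻¹≈ε⇒x≈y t x t-x≈0)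

  module RingEndomorphism
    (f : Carrier → Carrier)
    (f-cong : ∀ {x y} → x ≈ y → f x ≈ f y)
    (f-+ : ∀ x y → f (x + y) ≈ f x + f y)
    (f-* : ∀ x y → f (x * y) ≈ f x * f y)
    (f-1 : f 1# ≈ 1#)
    where

    f-0 : f 0# ≈ 0#
    f-0 = x+x≈x⇒x≈0 (f 0#) (trans (sym (f-+ 0# 0#)) (f-cong (+-identityʳ 0#)))

    f-neg : ∀ x → f (- x) ≈ - f x
    f-neg x = +-inverseˡ-unique (f (- x)) (f x)
      (trans (sym (f-+ (- x) x)) (trans (f-cong (-‿inverseˡ x)) f-0))

    f-sub : ∀ x y → f (x - y) ≈ f x - f y
    f-sub x y = trans (f-+ x (- y)) (+-cong refl (f-neg y))

    f-ι : ∀ n → f (ι n) ≈ ι n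
    f-ι zero    = f-0
    f-ι (suc n) = trans (f-+ 1# (ι n)) (+-cong f-1 (f-ι n))

    f-⁻¹ : ∀ {x} → ¬ (x ≈ 0#) → f (x ⁻¹) ≈ f x ⁻¹
    f-⁻¹ {x} x≉0 = x*y≈1⇒y≈x⁻¹ (λ fx≈0 → x≈0⇒x*y≉1 (f (x ⁻¹)) fx≈0 fx*fx⁻¹≈1) fx*fx⁻¹≈1
      where
      fx*fx⁻¹≈1 : f x * f (x ⁻¹) ≈ 1#
      fx*fx⁻¹≈1 = trans (sym (f-* x (x ⁻¹))) (trans (f-cong (⁻¹-inv x x≉0)) f-1)

  twistⁿ-cong : ∀ n {x y} → x ≈ y → twistⁿ n x ≈ twistⁿ n y
  twistⁿ-cong zero    x≈y = x≈y
  twistⁿ-cong (suc n) x≈y = twist-cong (twistⁿ-cong n x≈y)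

  twistⁿ-+ : ∀ n x y → twistⁿ n (x + y) ≈ twistⁿ n x + twistⁿ n y
  twistⁿ-+ zero    x y = refl
  twistⁿ-+ (suc n) x y = trans (twist-cong (twistⁿ-+ n x y)) (twist-+ _ _)

  twistⁿ-* : ∀ n x y → twistⁿ n (x * y) ≈ twistⁿ n x * twistⁿ n y
  twistⁿ-* zero    x y = refl
  twistⁿ-* (suc n) x y = trans (twist-cong (twistⁿ-* n x y)) (twist-* _ _)

  twistⁿ-1 : ∀ n → twistⁿ n 1# ≈ 1#
  twistⁿ-1 zero    = refl
  twistⁿ-1 (suc n) = trans (twist-cong (twistⁿ-1 n)) twist-1

  module Twistⁿ (n : ℕ) = RingEndomorphism (twistⁿ n) (twistⁿ-cong n) (twistⁿ-+ n) (twistⁿ-* n) (twistⁿ-1 n)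

  twistⁿ-t : ∀ n → twistⁿ n t ≈ t
  twistⁿ-t zero    = refl
  twistⁿ-t (suc n) = trans (twist-cong (twistⁿ-t n)) twist-t

  twistⁿ-κ₂ : ∀ n → twistⁿ n κ₂ ≈ κ₂
  twistⁿ-κ₂ zero    = refl
  twistⁿ-κ₂ (suc n) = trans (twist-cong (twistⁿ-κ₂ n)) (trans (twist-K κ₂∈K) κ₂-Fq)

  twistⁿ-suc-untwist : ∀ n x → twistⁿ (suc n) (untwist x) ≈ twistⁿ n x
  twistⁿ-suc-untwist zero    x = twist-untwist x
  twistⁿ-suc-untwist (suc n) x = twist-cong (twistⁿ-suc-untwist n x)

  twistⁿ-[t-x]⁻¹ : ∀ n {x} → inK x → twistⁿ n ((t - x) ⁻¹) ≈ (t - twistⁿ n x) ⁻¹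
  twistⁿ-[t-x]⁻¹ n {x} x∈K =
    trans (Twistⁿ.f-⁻¹ n (t-x≉0 x∈K)) (⁻¹-cong (trans (Twistⁿ.f-sub n t x) (+-cong (twistⁿ-t n) refl)))

  Σ-cong : ∀ {n} {f g : Fin n → Carrier} → (∀ i → f i ≈ g i) → Σ f ≈ Σ g
  Σ-cong {zero}  f≈g = refl
  Σ-cong {suc n} f≈g = +-cong (f≈g zero) (Σ-cong (λ i → f≈g (suc i)))

  Σ-0 : ∀ n → Σ {n} (λ _ → 0#) ≈ 0#
  Σ-0 zero    = refl
  Σ-0 (suc n) = trans (+-identityˡ _) (Σ-0 n)

  Σ-+ : ∀ {n} (f g : Fin n → Carrier) → Σ (λ i → f i + g i) ≈ Σ f + Σ g
  Σ-+ {zero}  f g = sym (+-identityʳ 0#)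
  Σ-+ {suc n} f g = trans (+-cong refl (Σ-+ (λ i → f (suc i)) (λ i → g (suc i))))
    (solve 4 (λ a b x y → (a :+ b) :+ (x :+ y) := (a :+ x) :+ (b :+ y)) refl (f zero) (g zero) _ _)

  *-distribˡ-Σ : ∀ {n} x (f : Fin n → Carrier) → x * Σ f ≈ Σ (λ i → x * f i)
  *-distribˡ-Σ {zero}  x f = zeroʳ x
  *-distribˡ-Σ {suc n} x f = trans (distribˡ x (f zero) _) (+-cong refl (*-distribˡ-Σ x (λ i → f (suc i))))

  *-distribʳ-Σ : ∀ {n} x (f : Fin n → Carrier) → Σ f * x ≈ Σ (λ i → f i * x)
  *-distribʳ-Σ {zero}  x f = zeroˡ x
  *-distribʳ-Σ {suc n} x f = trans (distribʳ x (f zero) _) (+-cong refl (*-distribʳ-Σ x (λ i → f (suc i))))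

  Σ-comm : ∀ {m n} (f : Fin m → Fin n → Carrier) → Σ (λ i → Σ (λ j → f i j)) ≈ Σ (λ j → Σ (λ i → f i j))
  Σ-comm {zero}  {n} f = sym (Σ-0 n)
  Σ-comm {suc m} f = trans (+-cong refl (Σ-comm (λ i j → f (suc i) j)))
                           (sym (Σ-+ (λ j → f zero j) (λ j → Σ (λ i → f (suc i) j))))

  IdM-suc : ∀ {n} (i j : Fin n) → IdM (suc i) (suc j) ≈ IdM i j
  IdM-suc i j with i ≟ j
  ... | yes _ = refl
  ... | no _  = refl

  Σ-*-IdM : ∀ {n} (f : Fin n → Carrier) j → Σ (λ k → f k * IdM k j) ≈ f j
  Σ-*-IdM {suc n} f zero =
    trans (+-cong (*-identityʳ (f zero)) (trans (Σ-cong (λ k → zeroʳ (f (suc k)))) (Σ-0 n))) (+-identityʳ _)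
  Σ-*-IdM {suc n} f (suc j) =
    trans (+-cong (zeroʳ (f zero)) (trans (Σ-cong (λ k → *-cong refl (IdM-suc k j))) (Σ-*-IdM (λ k → f (suc k)) j)))
          (+-identityˡ _)

  Σ-IdM-* : ∀ {n} (f : Fin n → Carrier) i → Σ (λ k → IdM i k * f k) ≈ f i
  Σ-IdM-* f i = trans (Σ-cong (λ k → *-comm (IdM i k) (f k)))
    (trans (Σ-cong (λ k → *-cong refl (IdM-sym i k))) (Σ-*-IdM f i))
    where
    IdM-sym : ∀ {n} (i k : Fin n) → IdM i k ≈ IdM k i
    IdM-sym zero    zero    = refl
    IdM-sym zero    (suc k) = refl
    IdM-sym (suc i) zero    = refl
    IdM-sym (suc i) (suc k) = trans (IdM-suc i k) (trans (IdM-sym i k) (sym (IdM-suc k i)))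

  Mat-setoid : ℕ → Setoid c ℓ
  Mat-setoid n = record
    { Carrier       = Mat n
    ; _≈_           = _≈M_
    ; isEquivalence = record
      { refl  = λ i j → refl
      ; sym   = λ A≈B i j → sym (A≈B i j)
      ; trans = λ A≈B B≈C i j → trans (A≈B i j) (B≈C i j)
      }
    }

  module ≈M-Reasoning {n : ℕ} = SetoidReasoning (Mat-setoid n)
  module ≈M {n : ℕ} = Setoid (Mat-setoid n)

  *M-cong : ∀ {n} {A A′ B B′ : Mat n} → A ≈M A′ → B ≈M B′ → (A *M B) ≈M (A′ *M B′)
  *M-cong A≈A′ B≈B′ i j = Σ-cong (λ k → *-cong (A≈A′ i k) (B≈B′ k j))

  *M-assoc : ∀ {n} (A B C : Mat n) → ((A *M B) *M C) ≈M (A *M (B *M C))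
  *M-assoc A B C i j = begin
    Σ (λ k → Σ (λ l → A i l * B l k) * C k j)      ≈⟨ Σ-cong (λ k → *-distribʳ-Σ (C k j) (λ l → A i l * B l k)) ⟩
    Σ (λ k → Σ (λ l → (A i l * B l k) * C k j))    ≈⟨ Σ-comm (λ k l → (A i l * B l k) * C k j) ⟩
    Σ (λ l → Σ (λ k → (A i l * B l k) * C k j))    ≈⟨ Σ-cong (λ l → Σ-cong (λ k → *-assoc (A i l) (B l k) (C k j))) ⟩
    Σ (λ l → Σ (λ k → A i l * (B l k * C k j)))    ≈⟨ Σ-cong (λ l → *-distribˡ-Σ (A i l) (λ k → B l k * C k j)) ⟨
    Σ (λ l → A i l * Σ (λ k → B l k * C k j))      ∎
    where open SetoidReasoning setoid

  *M-identityʳ : ∀ {n} (A : Mat n) → (A *M IdM) ≈M A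
  *M-identityʳ A i j = Σ-*-IdM (A i) j

  *M-identityˡ : ∀ {n} (A : Mat n) → (IdM *M A) ≈M A
  *M-identityˡ A i j = Σ-IdM-* (λ k → A k j) i

  *M-inverse-unique : ∀ {n} {N A A′ : Mat n} → (N *M A) ≈M IdM → (A *M A′) ≈M IdM → N ≈M A′
  *M-inverse-unique {N = N} {A} {A′} NA≈I AA′≈I = begin
    N                   ≈⟨ *M-identityʳ N ⟨
    N *M IdM            ≈⟨ *M-cong ≈M.refl AA′≈I ⟨
    N *M (A *M A′)      ≈⟨ *M-assoc N A A′ ⟨
    (N *M A) *M A′      ≈⟨ *M-cong NA≈I ≈M.refl ⟩
    IdM *M A′           ≈⟨ *M-identityˡ A′ ⟩
    A′                  ∎
    where open ≈M-Reasoning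

  twistM-cong : ∀ {k} n {A B : Mat k} → A ≈M B → twistM n A ≈M twistM n B
  twistM-cong n A≈B i j = twistⁿ-cong n (A≈B i j)

  𝓡-cong : ∀ {k} {N N′ : Mat k} → N ≈M N′ → ∀ m → 𝓡 N m ≈M 𝓡 N′ m
  𝓡-cong N≈N′ zero    = ≈M.refl
  𝓡-cong N≈N′ (suc m) = *M-cong (twistM-cong (suc m) N≈N′) (𝓡-cong N≈N′ m)

  kron²-cong : ∀ {A B : Mat 2} → A ≈M B → kron² A ≈M kron² B
  kron²-cong A≈B a b = *-cong (A≈B _ _) (A≈B _ _)

  sym²-cong : ∀ {A B : Mat 2} → A ≈M B → sym² A ≈M sym² B
  sym²-cong A≈B zero             zero             = *-cong (A≈B _ _) (A≈B _ _)
  sym²-cong A≈B zero             (suc zero)       = *-cong refl (*-cong (A≈B _ _) (A≈B _ _))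
  sym²-cong A≈B zero             (suc (suc zero)) = *-cong (A≈B _ _) (A≈B _ _)
  sym²-cong A≈B (suc zero)       zero             = *-cong (A≈B _ _) (A≈B _ _)
  sym²-cong A≈B (suc zero)       (suc zero)       = +-cong (*-cong (A≈B _ _) (A≈B _ _)) (*-cong (A≈B _ _) (A≈B _ _))
  sym²-cong A≈B (suc zero)       (suc (suc zero)) = *-cong (A≈B _ _) (A≈B _ _)
  sym²-cong A≈B (suc (suc zero)) zero             = *-cong (A≈B _ _) (A≈B _ _)
  sym²-cong A≈B (suc (suc zero)) (suc zero)       = *-cong refl (*-cong (A≈B _ _) (A≈B _ _))
  sym²-cong A≈B (suc (suc zero)) (suc (suc zero)) = *-cong (A≈B _ _) (A≈B _ _)

  alt²-cong : ∀ {A B : Mat 2} → A ≈M B → alt² A ≈M alt² B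
  alt²-cong A≈B _ _ = +-cong (*-cong (A≈B _ _) (A≈B _ _)) (-‿cong (*-cong (A≈B _ _) (A≈B _ _)))

  𝒯-cong : ∀ E {A B : Mat 2} → A ≈M B → 𝒯 E A ≈M 𝒯 E B
  𝒯-cong tensorE = kron²-cong
  𝒯-cong symE    = sym²-cong
  𝒯-cong altE    = alt²-cong

  kron²-IdM : kron² IdM ≈M IdM
  kron²-IdM zero                   zero                   = *-identityˡ 1#
  kron²-IdM zero                   (suc zero)             = zeroʳ _
  kron²-IdM zero                   (suc (suc zero))       = zeroˡ _
  kron²-IdM zero                   (suc (suc (suc zero))) = zeroˡ _
  kron²-IdM (suc zero)             zero                   = zeroʳ _
  kron²-IdM (suc zero)             (suc zero)             = *-identityˡ 1#
  kron²-IdM (suc zero)             (suc (suc zero))       = zeroˡ _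
  kron²-IdM (suc zero)             (suc (suc (suc zero))) = zeroˡ _
  kron²-IdM (suc (suc zero))       zero                   = zeroˡ _
  kron²-IdM (suc (suc zero))       (suc zero)             = zeroˡ _
  kron²-IdM (suc (suc zero))       (suc (suc zero))       = *-identityˡ 1#
  kron²-IdM (suc (suc zero))       (suc (suc (suc zero))) = zeroʳ _
  kron²-IdM (suc (suc (suc zero))) zero                   = zeroˡ _
  kron²-IdM (suc (suc (suc zero))) (suc zero)             = zeroˡ _
  kron²-IdM (suc (suc (suc zero))) (suc (suc zero))       = zeroʳ _
  kron²-IdM (suc (suc (suc zero))) (suc (suc (suc zero))) = *-identityˡ 1#

  sym²-IdM : sym² IdM ≈M IdM
  sym²-IdM zero             zero             = *-identityˡ 1#
  sym²-IdM zero             (suc zero)       = trans (*-cong refl (zeroʳ 1#)) (zeroʳ _)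
  sym²-IdM zero             (suc (suc zero)) = zeroˡ _
  sym²-IdM (suc zero)       zero             = zeroʳ _
  sym²-IdM (suc zero)       (suc zero)       = trans (+-cong (*-identityˡ 1#) (zeroˡ 0#)) (+-identityʳ 1#)
  sym²-IdM (suc zero)       (suc (suc zero)) = zeroˡ _
  sym²-IdM (suc (suc zero)) zero             = zeroˡ _
  sym²-IdM (suc (suc zero)) (suc zero)       = trans (*-cong refl (zeroˡ 1#)) (zeroʳ _)
  sym²-IdM (suc (suc zero)) (suc (suc zero)) = *-identityˡ 1#

  alt²-IdM : alt² IdM ≈M IdM
  alt²-IdM zero zero = trans (+-cong (*-identityˡ 1#) (trans (-‿cong (zeroˡ 0#)) -0#≈0#)) (+-identityʳ 1#)

  𝒯-IdM : ∀ E → 𝒯 E IdM ≈M IdM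
  𝒯-IdM tensorE = kron²-IdM
  𝒯-IdM symE    = sym²-IdM
  𝒯-IdM altE    = alt²-IdM

  kron²-*M : ∀ A B → kron² (A *M B) ≈M (kron² A *M kron² B)
  kron²-*M A B a b =
    solve 8 (λ x₀ x₁ y₀ y₁ z₀ z₁ w₀ w₁ →
               (x₀ :* y₀ :+ (x₁ :* y₁ :+ con 0)) :* (z₀ :* w₀ :+ (z₁ :* w₁ :+ con 0))
            := (x₀ :* z₀) :* (y₀ :* w₀) :+ ((x₀ :* z₁) :* (y₀ :* w₁)
               :+ ((x₁ :* z₀) :* (y₁ :* w₀) :+ ((x₁ :* z₁) :* (y₁ :* w₁) :+ con 0))))
      refl (A i zero) (A i (suc zero)) (B zero k) (B (suc zero) k)
           (A j zero) (A j (suc zero)) (B zero l) (B (suc zero) l)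
    where
    i j k l : Fin 2
    i = proj₁ (remQuot {2} 2 a)
    j = proj₂ (remQuot {2} 2 a)
    k = proj₁ (remQuot {2} 2 b)
    l = proj₂ (remQuot {2} 2 b)

  dotₚ : ∀ {n} → Polynomial n → Polynomial n → Polynomial n → Polynomial n → Polynomial n
  dotₚ x y z w = x :* z :+ (y :* w :+ con 0)

  -- sym²ₚ mirrors sym² on solver expressions, so every entry of sym²(AB) = sym² A sym² B
  -- is one polynomial identity in the entries of A and B.
  sym²ₚ : ∀ {n} → Polynomial n → Polynomial n → Polynomial n → Polynomial n → Fin 3 → Fin 3 → Polynomial n
  sym²ₚ p q r s zero             zero             = p :* p
  sym²ₚ p q r s zero             (suc zero)       = (con 1 :+ (con 1 :+ con 0)) :* (p :* q)
  sym²ₚ p q r s zero             (suc (suc zero)) = q :* q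
  sym²ₚ p q r s (suc zero)       zero             = p :* r
  sym²ₚ p q r s (suc zero)       (suc zero)       = p :* s :+ q :* r
  sym²ₚ p q r s (suc zero)       (suc (suc zero)) = q :* s
  sym²ₚ p q r s (suc (suc zero)) zero             = r :* r
  sym²ₚ p q r s (suc (suc zero)) (suc zero)       = (con 1 :+ (con 1 :+ con 0)) :* (r :* s)
  sym²ₚ p q r s (suc (suc zero)) (suc (suc zero)) = s :* s

  sym²-*M-entry : Fin 3 → Fin 3 → N-ary 8 (Polynomial 8) (Polynomial 8 × Polynomial 8)
  sym²-*M-entry i j a₁₁ a₁₂ a₂₁ a₂₂ b₁₁ b₁₂ b₂₁ b₂₂ =
    sym²ₚ (dotₚ a₁₁ a₁₂ b₁₁ b₂₁) (dotₚ a₁₁ a₁₂ b₁₂ b₂₂) (dotₚ a₂₁ a₂₂ b₁₁ b₂₁) (dotₚ a₂₁ a₂₂ b₁₂ b₂₂) i j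
    := (Aₚ i zero :* Bₚ zero j :+ (Aₚ i (suc zero) :* Bₚ (suc zero) j :+ (Aₚ i (suc (suc zero)) :* Bₚ (suc (suc zero)) j :+ con 0)))
    where
    Aₚ Bₚ : Fin 3 → Fin 3 → Polynomial 8
    Aₚ = sym²ₚ a₁₁ a₁₂ a₂₁ a₂₂
    Bₚ = sym²ₚ b₁₁ b₁₂ b₂₁ b₂₂

  sym²-*M : ∀ A B → sym² (A *M B) ≈M (sym² A *M sym² B)
  sym²-*M A B zero             zero             = solve 8 (sym²-*M-entry zero zero) refl (m₁₁ A) (m₁₂ A) (m₂₁ A) (m₂₂ A) (m₁₁ B) (m₁₂ B) (m₂₁ B) (m₂₂ B)
  sym²-*M A B zero             (suc zero)       = solve 8 (sym²-*M-entry zero (suc zero)) refl (m₁₁ A) (m₁₂ A) (m₂₁ A) (m₂₂ A) (m₁₁ B) (m₁₂ B) (m₂₁ B) (m₂₂ B)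
  sym²-*M A B zero             (suc (suc zero)) = solve 8 (sym²-*M-entry zero (suc (suc zero))) refl (m₁₁ A) (m₁₂ A) (m₂₁ A) (m₂₂ A) (m₁₁ B) (m₁₂ B) (m₂₁ B) (m₂₂ B)
  sym²-*M A B (suc zero)       zero             = solve 8 (sym²-*M-entry (suc zero) zero) refl (m₁₁ A) (m₁₂ A) (m₂₁ A) (m₂₂ A) (m₁₁ B) (m₁₂ B) (m₂₁ B) (m₂₂ B)
  sym²-*M A B (suc zero)       (suc zero)       = solve 8 (sym²-*M-entry (suc zero) (suc zero)) refl (m₁₁ A) (m₁₂ A) (m₂₁ A) (m₂₂ A) (m₁₁ B) (m₁₂ B) (m₂₁ B) (m₂₂ B)
  sym²-*M A B (suc zero)       (suc (suc zero)) = solve 8 (sym²-*M-entry (suc zero) (suc (suc zero))) refl (m₁₁ A) (m₁₂ A) (m₂₁ A) (m₂₂ A) (m₁₁ B) (m₁₂ B) (m₂₁ B) (m₂₂ B)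
  sym²-*M A B (suc (suc zero)) zero             = solve 8 (sym²-*M-entry (suc (suc zero)) zero) refl (m₁₁ A) (m₁₂ A) (m₂₁ A) (m₂₂ A) (m₁₁ B) (m₁₂ B) (m₂₁ B) (m₂₂ B)
  sym²-*M A B (suc (suc zero)) (suc zero)       = solve 8 (sym²-*M-entry (suc (suc zero)) (suc zero)) refl (m₁₁ A) (m₁₂ A) (m₂₁ A) (m₂₂ A) (m₁₁ B) (m₁₂ B) (m₂₁ B) (m₂₂ B)
  sym²-*M A B (suc (suc zero)) (suc (suc zero)) = solve 8 (sym²-*M-entry (suc (suc zero)) (suc (suc zero))) refl (m₁₁ A) (m₁₂ A) (m₂₁ A) (m₂₂ A) (m₁₁ B) (m₁₂ B) (m₂₁ B) (m₂₂ B)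

  alt²-*M : ∀ A B → alt² (A *M B) ≈M (alt² A *M alt² B)
  alt²-*M A B zero zero = begin
    alt² (A *M B) zero zero                    ≈⟨ x+w≈z+y⇒x-y≈z-w (expand (m₁₁ A) (m₁₂ A) (m₂₁ A) (m₂₂ A) (m₁₁ B) (m₁₂ B) (m₂₁ B) (m₂₂ B)) ⟩
    (a₊ * b₊ + a₋ * b₋) - (a₊ * b₋ + a₋ * b₊)  ≈⟨ [x-y]*[z-w]≈[xz+yw]-[xw+yz] a₊ a₋ b₊ b₋ ⟨
    (a₊ - a₋) * (b₊ - b₋)                      ≈⟨ +-identityʳ _ ⟨
    (alt² A *M alt² B) zero zero               ∎
    where
    open SetoidReasoning setoid
    a₊ a₋ b₊ b₋ : Carrier
    a₊ = m₁₁ A * m₂₂ A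
    a₋ = m₁₂ A * m₂₁ A
    b₊ = m₁₁ B * m₂₂ B
    b₋ = m₁₂ B * m₂₁ B
    -- both sides moved so that no subtraction occurs: the solver works over semirings
    expand : ∀ a₁₁ a₁₂ a₂₁ a₂₂ b₁₁ b₁₂ b₂₁ b₂₂ →
      (a₁₁ * b₁₁ + (a₁₂ * b₂₁ + 0#)) * (a₂₁ * b₁₂ + (a₂₂ * b₂₂ + 0#)) + ((a₁₁ * a₂₂) * (b₁₂ * b₂₁) + (a₁₂ * a₂₁) * (b₁₁ * b₂₂))
      ≈ ((a₁₁ * a₂₂) * (b₁₁ * b₂₂) + (a₁₂ * a₂₁) * (b₁₂ * b₂₁)) + (a₁₁ * b₁₂ + (a₁₂ * b₂₂ + 0#)) * (a₂₁ * b₁₁ + (a₂₂ * b₂₁ + 0#))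
    expand = solve 8 (λ a₁₁ a₁₂ a₂₁ a₂₂ b₁₁ b₁₂ b₂₁ b₂₂ →
        dotₚ a₁₁ a₁₂ b₁₁ b₂₁ :* dotₚ a₂₁ a₂₂ b₁₂ b₂₂ :+ ((a₁₁ :* a₂₂) :* (b₁₂ :* b₂₁) :+ (a₁₂ :* a₂₁) :* (b₁₁ :* b₂₂))
        := ((a₁₁ :* a₂₂) :* (b₁₁ :* b₂₂) :+ (a₁₂ :* a₂₁) :* (b₁₂ :* b₂₁)) :+ dotₚ a₁₁ a₁₂ b₁₂ b₂₂ :* dotₚ a₂₁ a₂₂ b₁₁ b₂₁)
      refl

  𝒯-*M : ∀ E (A B : Mat 2) → 𝒯 E (A *M B) ≈M (𝒯 E A *M 𝒯 E B)
  𝒯-*M tensorE = kron²-*M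
  𝒯-*M symE    = sym²-*M
  𝒯-*M altE    = alt²-*M

  kron²-twistM : ∀ n A → twistM n (kron² A) ≈M kron² (twistM n A)
  kron²-twistM n A a b = twistⁿ-* n _ _

  sym²-twistM : ∀ n A → twistM n (sym² A) ≈M sym² (twistM n A)
  sym²-twistM n A zero             zero             = twistⁿ-* n _ _
  sym²-twistM n A zero             (suc zero)       = trans (twistⁿ-* n _ _) (*-cong (Twistⁿ.f-ι n 2) (twistⁿ-* n _ _))
  sym²-twistM n A zero             (suc (suc zero)) = twistⁿ-* n _ _
  sym²-twistM n A (suc zero)       zero             = twistⁿ-* n _ _
  sym²-twistM n A (suc zero)       (suc zero)       = trans (twistⁿ-+ n _ _) (+-cong (twistⁿ-* n _ _) (twistⁿ-* n _ _))
  sym²-twistM n A (suc zero)       (suc (suc zero)) = twistⁿ-* n _ _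
  sym²-twistM n A (suc (suc zero)) zero             = twistⁿ-* n _ _
  sym²-twistM n A (suc (suc zero)) (suc zero)       = trans (twistⁿ-* n _ _) (*-cong (Twistⁿ.f-ι n 2) (twistⁿ-* n _ _))
  sym²-twistM n A (suc (suc zero)) (suc (suc zero)) = twistⁿ-* n _ _

  alt²-twistM : ∀ n A → twistM n (alt² A) ≈M alt² (twistM n A)
  alt²-twistM n A _ _ = trans (Twistⁿ.f-sub n _ _) (+-cong (twistⁿ-* n _ _) (-‿cong (twistⁿ-* n _ _)))

  𝒯-twistM : ∀ E n (A : Mat 2) → twistM n (𝒯 E A) ≈M 𝒯 E (twistM n A)
  𝒯-twistM tensorE = kron²-twistM
  𝒯-twistM symE    = sym²-twistM
  𝒯-twistM altE    = alt²-twistM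

  𝒯-𝓡 : ∀ E (N : Mat 2) m → 𝒯 E (𝓡 N m) ≈M 𝓡 (𝒯 E N) m
  𝒯-𝓡 E N zero    = 𝒯-IdM E
  𝒯-𝓡 E N (suc m) = begin
    𝒯 E (twistM (suc m) N *M 𝓡 N m)              ≈⟨ 𝒯-*M E (twistM (suc m) N) (𝓡 N m) ⟩
    𝒯 E (twistM (suc m) N) *M 𝒯 E (𝓡 N m)        ≈⟨ *M-cong (≈M.sym (𝒯-twistM E (suc m) N)) (𝒯-𝓡 E N m) ⟩
    twistM (suc m) (𝒯 E N) *M 𝓡 (𝒯 E N) m        ∎
    where open ≈M-Reasoning

  𝒯-inverse : ∀ E {A A′ : Mat 2} → (A *M A′) ≈M IdM → (𝒯 E A *M 𝒯 E A′) ≈M IdM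
  𝒯-inverse E {A} {A′} AA′≈I = begin
    𝒯 E A *M 𝒯 E A′     ≈⟨ 𝒯-*M E A A′ ⟨
    𝒯 E (A *M A′)       ≈⟨ 𝒯-cong E AA′≈I ⟩
    𝒯 E IdM             ≈⟨ 𝒯-IdM E ⟩
    IdM                 ∎
    where open ≈M-Reasoning

  Φφ⁻¹ : Mat 2
  Φφ⁻¹ zero       zero       = untwist κ₁ * (t - θ) ⁻¹
  Φφ⁻¹ zero       (suc zero) = κ₂ * (t - θ) ⁻¹
  Φφ⁻¹ (suc zero) zero       = 1#
  Φφ⁻¹ (suc zero) (suc zero) = 0#

  Φφ-*M-Φφ⁻¹ : (Φφ *M Φφ⁻¹) ≈M IdM
  Φφ-*M-Φφ⁻¹ zero       zero       = solve 1 (λ x → con 0 :* x :+ (con 1 :* con 1 :+ con 0) := con 1) refl _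
  Φφ-*M-Φφ⁻¹ zero       (suc zero) = solve 1 (λ x → con 0 :* x :+ (con 1 :* con 0 :+ con 0) := con 0) refl _
  Φφ-*M-Φφ⁻¹ (suc zero) zero       = begin
    ((t - θ) * κ₂ ⁻¹) * (untwist κ₁ * (t - θ) ⁻¹) + (- (untwist κ₁ * κ₂ ⁻¹) * 1# + 0#)
      ≈⟨ solve 5 (λ x k u d n → (x :* k) :* (u :* d) :+ (n :* con 1 :+ con 0) := (u :* k) :* (x :* d) :+ n)
                 refl (t - θ) (κ₂ ⁻¹) (untwist κ₁) ((t - θ) ⁻¹) (- (untwist κ₁ * κ₂ ⁻¹)) ⟩
    (untwist κ₁ * κ₂ ⁻¹) * ((t - θ) * (t - θ) ⁻¹) - untwist κ₁ * κ₂ ⁻¹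
      ≈⟨ +-cong (trans (*-cong refl (⁻¹-inv _ (t-x≉0 θ∈K))) (*-identityʳ _)) refl ⟩
    untwist κ₁ * κ₂ ⁻¹ - untwist κ₁ * κ₂ ⁻¹
      ≈⟨ -‿inverseʳ _ ⟩
    0# ∎
    where open SetoidReasoning setoid
  Φφ-*M-Φφ⁻¹ (suc zero) (suc zero) = begin
    ((t - θ) * κ₂ ⁻¹) * (κ₂ * (t - θ) ⁻¹) + (- (untwist κ₁ * κ₂ ⁻¹) * 0# + 0#)
      ≈⟨ solve 5 (λ x k' k d n → (x :* k') :* (k :* d) :+ (n :* con 0 :+ con 0) := (x :* d) :* (k :* k'))
                 refl (t - θ) (κ₂ ⁻¹) κ₂ ((t - θ) ⁻¹) (- (untwist κ₁ * κ₂ ⁻¹)) ⟩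
    ((t - θ) * (t - θ) ⁻¹) * (κ₂ * κ₂ ⁻¹)
      ≈⟨ *-cong (⁻¹-inv _ (t-x≉0 θ∈K)) (⁻¹-inv κ₂ κ₂≉0) ⟩
    1# * 1#
      ≈⟨ *-identityˡ 1# ⟩
    1# ∎
    where open SetoidReasoning setoid

  Bstep : ℕ → Mat 2
  Bstep n zero       zero       = twistⁿ n κ₁ * (t - twistⁿ (suc n) θ) ⁻¹
  Bstep n zero       (suc zero) = κ₂ * (t - twistⁿ (suc n) θ) ⁻¹
  Bstep n (suc zero) zero       = 1#
  Bstep n (suc zero) (suc zero) = 0#

  twistM-Φφ⁻¹ : ∀ n → twistM (suc n) Φφ⁻¹ ≈M Bstep n
  twistM-Φφ⁻¹ n zero       zero       =
    trans (twistⁿ-* (suc n) _ _) (*-cong (twistⁿ-suc-untwist n κ₁) (twistⁿ-[t-x]⁻¹ (suc n) θ∈K))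
  twistM-Φφ⁻¹ n zero       (suc zero) =
    trans (twistⁿ-* (suc n) _ _) (*-cong (twistⁿ-κ₂ (suc n)) (twistⁿ-[t-x]⁻¹ (suc n) θ∈K))
  twistM-Φφ⁻¹ n (suc zero) zero       = twistⁿ-1 (suc n)
  twistM-Φφ⁻¹ n (suc zero) (suc zero) = Twistⁿ.f-0 (suc n)

  twist-Bstep : ∀ n → twistM 1 (Bstep n) ≈M Bstep (suc n)
  twist-Bstep n i j = trans (twist-cong (sym (twistM-Φφ⁻¹ n i j))) (twistM-Φφ⁻¹ (suc n) i j)

  twist-B-suc : ∀ n → twist (B (suc n)) ≈ Bstep (suc n) zero zero * twist (B n) + Bstep (suc n) zero (suc zero) * twist (Bprev n)
  twist-B-suc n = trans (twist-+ _ _)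
    (+-cong (trans (twist-* _ _) (*-cong (twist-Bstep n zero zero) refl))
            (trans (twist-* _ _) (*-cong (twist-Bstep n zero (suc zero)) refl)))

  Bstep-zero : Bstep 0 ≈M Bmat 0
  Bstep-zero zero       zero       = sym (solve 2 (λ x y → x :* con 1 :+ y :* con 0 := x) refl _ _)
  Bstep-zero zero       (suc zero) = sym (trans (*-cong refl twist-1) (*-identityʳ _))
  Bstep-zero (suc zero) zero       = refl
  Bstep-zero (suc zero) (suc zero) = sym (trans (*-cong refl (Twistⁿ.f-0 1)) (zeroʳ _))

  Bstep-*M-Bmat : ∀ n → (Bstep (suc n) *M Bmat n) ≈M Bmat (suc n)
  Bstep-*M-Bmat n zero       zero       = +-cong refl (+-identityʳ _)
  Bstep-*M-Bmat n zero       (suc zero) = begin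
    a * (w * twist (B n)) + (b * (w * twist (Bprev n)) + 0#)
      ≈⟨ solve 5 (λ a b w x y → a :* (w :* x) :+ (b :* (w :* y) :+ con 0) := w :* (a :* x :+ b :* y)) refl a b w _ _ ⟩
    w * (a * twist (B n) + b * twist (Bprev n))
      ≈⟨ *-cong refl (twist-B-suc n) ⟨
    w * twist (B (suc n)) ∎
    where
    open SetoidReasoning setoid
    a b w : Carrier
    a = Bstep (suc n) zero zero
    b = Bstep (suc n) zero (suc zero)
    w = κ₂ * (t - twist θ) ⁻¹
  Bstep-*M-Bmat n (suc zero) zero       = solve 2 (λ x y → con 1 :* x :+ (con 0 :* y :+ con 0) := x) refl _ _
  Bstep-*M-Bmat n (suc zero) (suc zero) = solve 2 (λ x y → con 1 :* x :+ (con 0 :* y :+ con 0) := x) refl _ _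

  𝓡-Φφ⁻¹ : ∀ m → 𝓡 Φφ⁻¹ (suc m) ≈M Bmat m
  𝓡-Φφ⁻¹ zero    = begin
    twistM 1 Φφ⁻¹ *M IdM     ≈⟨ *M-identityʳ _ ⟩
    twistM 1 Φφ⁻¹            ≈⟨ twistM-Φφ⁻¹ 0 ⟩
    Bstep 0                  ≈⟨ Bstep-zero ⟩
    Bmat 0                   ∎
    where open ≈M-Reasoning
  𝓡-Φφ⁻¹ (suc m) = begin
    twistM (suc (suc m)) Φφ⁻¹ *M 𝓡 Φφ⁻¹ (suc m)   ≈⟨ *M-cong (twistM-Φφ⁻¹ (suc m)) (𝓡-Φφ⁻¹ m) ⟩
    Bstep (suc m) *M Bmat m                       ≈⟨ Bstep-*M-Bmat m ⟩
    Bmat (suc m)                                  ∎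
    where open ≈M-Reasoning

proposition5p2p27 : ∀ {c ℓ : Level} (S : Setting c ℓ) → let open Setting S in
    (E : Kind) (Φinv : Mat (dim E)) →
    (Φinv *M ΦE E) ≈M IdM → (ΦE E *M Φinv) ≈M IdM →
    (m : ℕ) → 𝓡 Φinv (suc m) ≈M 𝒯 E (Bmat m)
proposition5p2p27 S E Φinv Φinv-*M-ΦE _ m = begin
  𝓡 Φinv (suc m)              ≈⟨ 𝓡-cong Φinv≈𝒯Φφ⁻¹ (suc m) ⟩
  𝓡 (𝒯 E Φφ⁻¹) (suc m)        ≈⟨ 𝒯-𝓡 E Φφ⁻¹ (suc m) ⟨
  𝒯 E (𝓡 Φφ⁻¹ (suc m))        ≈⟨ 𝒯-cong E (𝓡-Φφ⁻¹ m) ⟩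
  𝒯 E (Bmat m)                ∎
  where
  open Setting S
  open Theory S
  open ≈M-Reasoning
  Φinv≈𝒯Φφ⁻¹ : Φinv ≈M 𝒯 E Φφ⁻¹
  Φinv≈𝒯Φφ⁻¹ = *M-inverse-unique Φinv-*M-ΦE (𝒯-inverse E Φφ-*M-Φφ⁻¹)
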